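{- For every integer $n \geq 2$, the path $P_n$ on $n$ vertices satisfies $D_e(P_n) = 2$.
   Context: An endomorphism of a simple graph $G=(V,E)$ is a map $\phi: V\to V$ such that $\phi(u)\phi(v)\in E$ whenever $uv\in E$. A labeling $c$ of $V$ is preserved by $\phi$ if $c(\phi(v))=c(v)$ for all $v$. The endomorphism distinguishing number $D_e(G)$ is the least cardinal $d$ such that $G$ has a labeling with $d$ labels preserved only by the identity endomorphism. -}

module Defs where

open import Data.Nat using (ℕ; suc; _≤_)
open import Data.Fin using (Fin; toℕ)
open import Data.Product using (Σ; _×_)
open import Data.Sum using (_⊎_)
open import Relation.Binary.PropositionalEquality using (_≡_)
open import Data.Empty using (⊥)
open import Data.Sum using (inj₁; inj₂)
open import Data.Nat.Properties using (suc-injective)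
open import Relation.Binary.PropositionalEquality using (sym)

record Graph : Set₁ where
  field
    V    : Set
    Adj  : V → V → Set
    irrefl : ∀ {u} → Adj u u → ⊥
    symm : ∀ {u v} → Adj u v → Adj v u

open Graph public

IsEndomorphism : (G : Graph) → (V G → V G) → Set
IsEndomorphism G φ = ∀ u v → Adj G u v → Adj G (φ u) (φ v)

Preserves : (G : Graph) {d : ℕ} → (V G → Fin d) → (V G → V G) → Set
Preserves G c φ = ∀ v → c (φ v) ≡ c v

IsEndoDistinguishing : (G : Graph) {d : ℕ} → (V G → Fin d) → Set
IsEndoDistinguishing G c =
  ∀ φ → IsEndomorphism G φ → Preserves G c φ → ∀ v → φ v ≡ v

EndoDistinguishableWith : Graph → ℕ → Set
EndoDistinguishableWith G d = Σ (V G → Fin d) (IsEndoDistinguishing G)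

-- D_e(G) = d : d labels suffice and d is least such.
-- (For finite graphs D_e is a natural number, since the labeling with
-- one label per vertex is distinguishing.)
EndoDistNumberIs : Graph → ℕ → Set
EndoDistNumberIs G d =
  EndoDistinguishableWith G d × (∀ k → EndoDistinguishableWith G k → d ≤ k)

PathAdj : (n : ℕ) → Fin n → Fin n → Set
PathAdj n i j = (toℕ j ≡ suc (toℕ i)) ⊎ (toℕ i ≡ suc (toℕ j))

n≢1+n : ∀ m → m ≡ suc m → ⊥
n≢1+n (suc m) e = n≢1+n m (suc-injective e)

PathAdj-irrefl : ∀ {n} {i : Fin n} → PathAdj n i i → ⊥
PathAdj-irrefl {i = i} (inj₁ e) = n≢1+n (toℕ i) e
PathAdj-irrefl {i = i} (inj₂ e) = n≢1+n (toℕ i) e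

PathAdj-sym : ∀ {n} {i j : Fin n} → PathAdj n i j → PathAdj n j i
PathAdj-sym (inj₁ e) = inj₂ e
PathAdj-sym (inj₂ e) = inj₁ e

P : ℕ → Graph
P n = record { V = Fin n ; Adj = PathAdj n ; irrefl = PathAdj-irrefl ; symm = PathAdj-sym }

-- An endomorphism of a path sends consecutive vertices to consecutive vertices, so it traces
-- a walk φ 0, φ 1, …, φ (n − 1). Label the path 0, 0, 1, 1, 0, 0, 1, 1, … (possibly shifted by
-- one). Vertices at distance two get different labels, so a label-preserving walk never steps
-- back and is therefore monotone; inside P_n this makes φ the identity or the reversal, and the
-- shift is chosen so that the reversal does not preserve the labels. One label is not enough,
-- since folding the path onto its first edge is a non-identity endomorphism.
module Submission where

open import Defs
open import Data.Nat using (ℕ; zero; suc; _+_; _≤_; _<_; z≤n; s≤s)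
open import Data.Nat.Properties
  using (suc-injective; +-suc; +-identityʳ; +-cancelˡ-≤; m≤m+n; m⊓n≤n; m≤n⇒m⊓n≡m;
         n≤0⇒n≡0; <⇒≤; ≤-refl; ≤-antisym)
open import Data.Fin using (Fin; toℕ; fromℕ<; opposite; _↑ˡ_) renaming (zero to fzero; suc to fsuc)
open import Data.Fin.Properties using (toℕ-fromℕ<; toℕ-injective; toℕ≤pred[n]; 0≢1+n)
open import Data.Product using (_,_; _×_; ∃-syntax)
open import Data.Sum using (_⊎_; inj₁; inj₂)
open import Data.Empty using (⊥-elim)
open import Function using (_∘_)
open import Relation.Nullary using (¬_)
open import Relation.Binary.PropositionalEquality
open ≡-Reasoning

_∼_ : ℕ → ℕ → Set
x ∼ y = (y ≡ suc x) ⊎ (x ≡ suc y)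

module MonotoneWalk {a : ℕ → ℕ} {N : ℕ}
  (step : ∀ {k} → k < N → a k ∼ a (suc k))
  (no-backtrack : ∀ {k} → 2 + k ≤ N → a (2 + k) ≢ a k) where

  ascent-continues : ∀ {k} → 2 + k ≤ N → a (suc k) ≡ suc (a k) → a (2 + k) ≡ suc (a (suc k))
  ascent-continues k+2≤N up with step k+2≤N
  ... | inj₁ up′  = up′
  ... | inj₂ down = ⊥-elim (no-backtrack k+2≤N (suc-injective (trans (sym down) up)))

  descent-continues : ∀ {k} → 2 + k ≤ N → a k ≡ suc (a (suc k)) → a (suc k) ≡ suc (a (2 + k))
  descent-continues k+2≤N down with step k+2≤N
  ... | inj₁ up   = ⊥-elim (no-backtrack k+2≤N (trans up (sym down)))
  ... | inj₂ down′ = down′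

  ascending-step : a 1 ≡ suc (a 0) → ∀ {k} → k < N → a (suc k) ≡ suc (a k)
  ascending-step up {zero}  _   = up
  ascending-step up {suc k} k<N = ascent-continues k<N (ascending-step up (<⇒≤ k<N))

  descending-step : a 0 ≡ suc (a 1) → ∀ {k} → k < N → a k ≡ suc (a (suc k))
  descending-step down {zero}  _   = down
  descending-step down {suc k} k<N = descent-continues k<N (descending-step down (<⇒≤ k<N))

  ascending : a 1 ≡ suc (a 0) → ∀ {k} → k ≤ N → a k ≡ k + a 0
  ascending up {zero}  _   = refl
  ascending up {suc k} k<N = trans (ascending-step up k<N) (cong suc (ascending up (<⇒≤ k<N)))

  descending : a 0 ≡ suc (a 1) → ∀ {k} → k ≤ N → k + a k ≡ a 0
  descending down {zero}  _   = refl
  descending down {suc k} k<N = begin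
    suc k + a (suc k)   ≡⟨ +-suc k (a (suc k)) ⟨
    k + suc (a (suc k)) ≡⟨ cong (k +_) (descending-step down k<N) ⟨
    k + a k             ≡⟨ descending down (<⇒≤ k<N) ⟩
    a 0                 ∎

  monotone : 1 ≤ N → (∀ {k} → k ≤ N → a k ≡ k + a 0) ⊎ (∀ {k} → k ≤ N → k + a k ≡ a 0)
  monotone 1≤N with step 1≤N
  ... | inj₁ up   = inj₁ (ascending up)
  ... | inj₂ down = inj₂ (descending down)

  -- An ascending walk that stays ≤ N must start at 0, a descending one at N.
  identity-or-reversal : 1 ≤ N → (∀ {k} → k ≤ N → a k ≤ N) →
                         (∀ {k} → k ≤ N → a k ≡ k) ⊎ (∀ {k} → k ≤ N → k + a k ≡ N)
  identity-or-reversal 1≤N bounded with monotone 1≤N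
  ... | inj₁ asc = inj₁ λ {k} k≤N → trans (asc k≤N) (trans (cong (k +_) a0≡0) (+-identityʳ k))
    where
    a0≡0 : a 0 ≡ 0
    a0≡0 = n≤0⇒n≡0 (+-cancelˡ-≤ N (a 0) 0
             (subst₂ _≤_ (asc ≤-refl) (sym (+-identityʳ N)) (bounded ≤-refl)))
  ... | inj₂ desc = inj₂ λ k≤N → trans (desc k≤N) a0≡N
    where
    a0≡N : a 0 ≡ N
    a0≡N = ≤-antisym (bounded z≤n) (subst (N ≤_) (desc ≤-refl) (m≤m+n N (a N)))

DiffersAtDistanceTwo : ∀ {d} → (ℕ → Fin d) → Set
DiffersAtDistanceTwo ℓ = ∀ k → ℓ (2 + k) ≢ ℓ k

-- Indices beyond N are sent to N, so that a vertex map can be read as a sequence on ℕ.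
clamp : ∀ {N} → ℕ → Fin (suc N)
clamp {N} k = fromℕ< (s≤s (m⊓n≤n k N))

toℕ-clamp : ∀ {N k} → k ≤ N → toℕ (clamp {N} k) ≡ k
toℕ-clamp k≤N = trans (toℕ-fromℕ< _) (m≤n⇒m⊓n≡m k≤N)

clamp-toℕ : ∀ {N} (v : Fin (suc N)) → clamp (toℕ v) ≡ v
clamp-toℕ v = toℕ-injective (toℕ-clamp (toℕ≤pred[n] v))

module PathEndomorphism {d N : ℕ} {ℓ : ℕ → Fin d} (ℓ-differs : DiffersAtDistanceTwo ℓ)
  {φ : Fin (suc N) → Fin (suc N)}
  (endo : IsEndomorphism (P (suc N)) φ)
  (pres : Preserves (P (suc N)) (ℓ ∘ toℕ) φ) where

  walk : ℕ → ℕ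
  walk k = toℕ (φ (clamp k))

  walk-toℕ : ∀ v → walk (toℕ v) ≡ toℕ (φ v)
  walk-toℕ v = cong (toℕ ∘ φ) (clamp-toℕ v)

  walk-step : ∀ {k} → k < N → walk k ∼ walk (suc k)
  walk-step {k} k<N = endo (clamp k) (clamp (suc k))
    (inj₁ (trans (toℕ-clamp k<N) (cong suc (sym (toℕ-clamp (<⇒≤ k<N))))))

  walk-label : ∀ {k} → k ≤ N → ℓ (walk k) ≡ ℓ k
  walk-label {k} k≤N = trans (pres (clamp k)) (cong ℓ (toℕ-clamp k≤N))

  walk-no-backtrack : ∀ {k} → 2 + k ≤ N → walk (2 + k) ≢ walk k
  walk-no-backtrack {k} k+2≤N eq = ℓ-differs k (begin
    ℓ (2 + k)        ≡⟨ walk-label k+2≤N ⟨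
    ℓ (walk (2 + k)) ≡⟨ cong ℓ eq ⟩
    ℓ (walk k)       ≡⟨ walk-label (<⇒≤ (<⇒≤ k+2≤N)) ⟩
    ℓ k              ∎)

  identity-or-reversal : 1 ≤ N → (∀ v → φ v ≡ v) ⊎ (∀ v → toℕ v + toℕ (φ v) ≡ N)
  identity-or-reversal 1≤N
    with MonotoneWalk.identity-or-reversal walk-step walk-no-backtrack 1≤N (λ _ → toℕ≤pred[n] _)
  ... | inj₁ fixes    = inj₁ λ v → toℕ-injective (trans (sym (walk-toℕ v)) (fixes (toℕ≤pred[n] v)))
  ... | inj₂ reverses = inj₂ λ v → trans (cong (toℕ v +_) (sym (walk-toℕ v))) (reverses (toℕ≤pred[n] v))

-- The reversal of P (2 + m) swaps the vertices 0 ↔ m + 1 and 1 ↔ m.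
MirroredEnds : ∀ {d} → (ℕ → Fin d) → ℕ → Set
MirroredEnds ℓ m = ℓ (suc m) ≡ ℓ 0 × ℓ m ≡ ℓ 1

differs-unmirrored⇒distinguishing : ∀ {d m} {ℓ : ℕ → Fin d} →
  DiffersAtDistanceTwo ℓ → ¬ MirroredEnds ℓ m → IsEndoDistinguishing (P (2 + m)) (ℓ ∘ toℕ)
differs-unmirrored⇒distinguishing {m = m} {ℓ} differs unmirrored φ endo pres
  with PathEndomorphism.identity-or-reversal differs endo pres (s≤s z≤n)
... | inj₁ fixes    = fixes
... | inj₂ reverses = ⊥-elim (unmirrored (end₀ , end₁))
  where
  end₀ : ℓ (suc m) ≡ ℓ 0
  end₀ = trans (cong ℓ (sym (reverses fzero))) (pres fzero)
  end₁ : ℓ m ≡ ℓ 1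
  end₁ = trans (cong ℓ (suc-injective (sym (reverses (fsuc fzero))))) (pres (fsuc fzero))

pairs : ℕ → Fin 2
pairs 0             = fzero
pairs 1             = fzero
pairs (suc (suc k)) = opposite (pairs k)

opposite-≢ : (i : Fin 2) → opposite i ≢ i
opposite-≢ fzero        ()
opposite-≢ (fsuc fzero) ()

pairs-differs : DiffersAtDistanceTwo pairs
pairs-differs k = opposite-≢ (pairs k)

-- pairs itself has mirrored ends exactly when m ≡ 0 (mod 4); then its shift by one does not.
unmirrored-labeling : ∀ m → ∃[ ℓ ] (DiffersAtDistanceTwo ℓ × ¬ MirroredEnds ℓ m)
unmirrored-labeling m with pairs m in eq₀ | pairs (suc m) in eq₁
... | fzero        | fzero        = pairs ∘ suc , pairs-differs ∘ suc , λ (_ , e) → 0≢1+n (trans (sym eq₁) e)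
... | fsuc fzero   | _            = pairs , pairs-differs , λ (_ , e) → 0≢1+n (trans (sym e) eq₀)
... | fzero        | fsuc fzero   = pairs , pairs-differs , λ (e , _) → 0≢1+n (trans (sym e) eq₁)

needs-two-labels : ∀ {G : Graph} (v : V G) {φ : V G → V G} → IsEndomorphism G φ → φ v ≢ v →
                   ∀ k → EndoDistinguishableWith G k → 2 ≤ k
needs-two-labels v endo moved zero (c , _) with c v
... | ()
needs-two-labels {G} v {φ} endo moved 1 (c , distinguishing) =
  ⊥-elim (moved (distinguishing φ endo single-label v))
  where
  single-label : Preserves G c φ
  single-label u with c (φ u) | c u
  ... | fzero | fzero = refl
needs-two-labels _ _ _ (suc (suc k)) _ = s≤s (s≤s z≤n)

parity : ℕ → Fin 2
parity zero    = fzero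
parity (suc k) = opposite (parity k)

-- Folds P (2 + m) onto its first edge, exchanging the endpoints 0 and 1.
fold : ∀ m → Fin (2 + m) → Fin (2 + m)
fold m v = parity (suc (toℕ v)) ↑ˡ m

parity-adjacent : ∀ m k → PathAdj (2 + m) (parity k ↑ˡ m) (parity (suc k) ↑ˡ m)
parity-adjacent m k with parity k
... | fzero      = inj₁ refl
... | fsuc fzero = inj₂ refl

fold-endo : ∀ m → IsEndomorphism (P (2 + m)) (fold m)
fold-endo m u v (inj₁ v≡1+u) = subst (PathAdj (2 + m) (fold m u))
  (cong (λ j → parity (suc j) ↑ˡ m) (sym v≡1+u)) (parity-adjacent m (suc (toℕ u)))
fold-endo m u v (inj₂ u≡1+v) = PathAdj-sym (fold-endo m v u (inj₁ u≡1+v))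

lemma11 : (n : ℕ) → 2 ≤ n → EndoDistNumberIs (P n) 2
lemma11 (suc (suc m)) (s≤s (s≤s z≤n)) with unmirrored-labeling m
... | ℓ , differs , unmirrored =
  (ℓ ∘ toℕ , differs-unmirrored⇒distinguishing differs unmirrored) ,
  needs-two-labels {P (2 + m)} fzero (fold-endo m) (λ ())
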